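{- For every $n\geq 1$, \[ \mathfrak{T}_{n+1}=011\mathcal{F}_n\cup 101\mathcal{F}_n\cup 010\mathcal{T}_n\cup 100\mathcal{T}_n\cup 00\mathcal{T}_{n+1}\cup 11\mathcal{T}_{n+1}. \]
   Context: Words are over $\{0,1\}$; $\varepsilon$ is the empty word, $w^k$ is $k$ concatenated copies of $w$, and $uX=\{uw:w\in X\}$. Define $\mathcal{T}_0=\varnothing$, $\mathcal{T}_1=\{0\}$, $\mathcal{T}_n=\{1^k01^{n-k-1}:0\leq k\leq n-1\}$ for $n\ge2$; $\mathcal{F}_0=\{\varepsilon\}$, $\mathcal{F}_1=\{1\}$, $\mathcal{F}_n=\{1^p01^k01^{n-p-k-2}:0\le p\le n-2,\ 0\le k\le n-p-2\}\cup\{1^n\}$ for $n\ge2$ (so that $\mathcal{F}_n=0\mathcal{T}_{n-1}\cup1\mathcal{F}_{n-1}$ for $n\ge2$); $\mathfrak{T}_0=\{01,10\}$ and $\mathfrak{T}_n=01\mathcal{F}_n\cup10\mathcal{F}_n\cup00\mathcal{T}_n\cup11\mathcal{T}_n$ for $n\ge1$. (These are the encodings of the two-component states of the $n$-twist loop, the $n$-foil and the $n$-twist knot shadow respectively.) -}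

module Defs where

open import Data.Bool using (Bool; true; false)
open import Data.List using (List; []; _∷_; _++_; replicate)
open import Data.Nat using (ℕ; zero; suc; _+_; _∸_; _≤_)
open import Data.Product using (Σ; ∃; _×_; _,_)
open import Data.Sum using (_⊎_)
open import Relation.Binary.PropositionalEquality using (_≡_)
open import Function.Bundles using (_⇔_)

-- Words over {0,1}: 0 = false, 1 = true.
Word : Set
Word = List Bool

Lang : Set₁
Lang = Word → Set

1^ : ℕ → Word
1^ k = replicate k true

_·_ : Word → Lang → Lang
(u · X) w = ∃ λ v → X v × w ≡ u ++ v

infixr 6 _·_

_∪_ : Lang → Lang → Lang
(X ∪ Y) w = X w ⊎ Y w

infixr 5 _∪_

_≐_ : Lang → Lang → Set
X ≐ Y = ∀ w → X w ⇔ Y w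

infix 4 _≐_

𝒯 : ℕ → Lang
𝒯 zero w = Data.Empty.⊥
  where import Data.Empty
𝒯 (suc zero) w = w ≡ false ∷ []
𝒯 (suc (suc m)) w =
  let n = suc (suc m) in
  ∃ λ k → k ≤ n ∸ 1 × w ≡ 1^ k ++ false ∷ 1^ (n ∸ k ∸ 1)

ℱ : ℕ → Lang
ℱ zero w = w ≡ []
ℱ (suc zero) w = w ≡ true ∷ []
ℱ (suc (suc m)) w =
  let n = suc (suc m) in
  (∃ λ p → ∃ λ k → p ≤ n ∸ 2 × k ≤ n ∸ p ∸ 2 ×
     w ≡ 1^ p ++ false ∷ 1^ k ++ false ∷ 1^ (n ∸ p ∸ k ∸ 2))
  ⊎ w ≡ 1^ n

𝔗 : ℕ → Lang
𝔗 zero w = w ≡ false ∷ true ∷ [] ⊎ w ≡ true ∷ false ∷ []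
𝔗 (suc m) =
  let n = suc m in
  ((false ∷ true ∷ []) · ℱ n) ∪ ((true ∷ false ∷ []) · ℱ n)
  ∪ ((false ∷ false ∷ []) · 𝒯 n) ∪ ((true ∷ true ∷ []) · 𝒯 n)

module Submission where

-- The only combinatorial input
-- is the recursion of the n-foil words,
--     ℱ(n+1) = 0𝒯(n) ∪ 1ℱ(n)   (n ≥ 1),
-- obtained by splitting a word of ℱ(n+1) on its first letter.
-- Substituting the recursion into 01ℱ(n+1) and 10ℱ(n+1), distributing and
-- reshuffling yields exactly the six families of the theorem.

open import Defs
open import Level using (0ℓ) renaming (suc to lsuc)
open import Data.Bool using (true; false)
open import Data.List using ([]; _∷_; _++_)
open import Data.List.Properties using (++-assoc)
open import Data.Nat using (ℕ; suc; zero; _+_; _≤_; _∸_; z≤n; s≤s)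
open import Data.Nat.Properties using (∸-+-assoc; +-suc)
open import Data.Product using (_,_)
open import Data.Sum using (inj₁; inj₂)
open import Function.Bundles using (mk⇔; Equivalence)
open import Function.Properties.Equivalence using (⇔-isEquivalence)
open import Relation.Binary.Bundles using (Setoid)
open import Relation.Binary.Structures using (IsEquivalence)
open import Relation.Binary.PropositionalEquality
  using (_≡_; refl; sym; cong; module ≡-Reasoning)
import Relation.Binary.Reasoning.Setoid as SetoidReasoning

≐-setoid : Setoid (lsuc 0ℓ) 0ℓ
≐-setoid = record
  { Carrier       = Lang
  ; _≈_           = _≐_
  ; isEquivalence = record
    { refl  = λ w → IsEquivalence.refl ⇔-isEquivalence
    ; sym   = λ X≐Y w → IsEquivalence.sym ⇔-isEquivalence (X≐Y w)
    ; trans = λ X≐Y Y≐Z w → IsEquivalence.trans ⇔-isEquivalence (X≐Y w) (Y≐Z w)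
    }
  }

open Setoid ≐-setoid using () renaming (refl to ≐-refl)

·-cong : ∀ u {X Y} → X ≐ Y → u · X ≐ u · Y
·-cong u X≐Y w = mk⇔
  (λ { (v , Xv , refl) → v , Equivalence.to (X≐Y v) Xv , refl })
  (λ { (v , Yv , refl) → v , Equivalence.from (X≐Y v) Yv , refl })

∪-cong : ∀ {X X′ Y Y′} → X ≐ X′ → Y ≐ Y′ → X ∪ Y ≐ X′ ∪ Y′
∪-cong X≐X′ Y≐Y′ w = mk⇔
  (λ { (inj₁ x) → inj₁ (Equivalence.to (X≐X′ w) x)
     ; (inj₂ y) → inj₂ (Equivalence.to (Y≐Y′ w) y) })
  (λ { (inj₁ x) → inj₁ (Equivalence.from (X≐X′ w) x)
     ; (inj₂ y) → inj₂ (Equivalence.from (Y≐Y′ w) y) })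

·-distrib-∪ : ∀ u X Y → u · (X ∪ Y) ≐ u · X ∪ u · Y
·-distrib-∪ u X Y w = mk⇔
  (λ { (v , inj₁ Xv , eq) → inj₁ (v , Xv , eq)
     ; (v , inj₂ Yv , eq) → inj₂ (v , Yv , eq) })
  (λ { (inj₁ (v , Xv , eq)) → v , inj₁ Xv , eq
     ; (inj₂ (v , Yv , eq)) → v , inj₂ Yv , eq })

·-assoc : ∀ u v X → u · v · X ≐ (u ++ v) · X
·-assoc u v X w = mk⇔
  (λ { (_ , (x , Xx , refl) , refl) → x , Xx , sym (++-assoc u v x) })
  (λ { (x , Xx , refl) → v ++ x , (x , Xx , refl) , ++-assoc u v x })

∪-interleave : ∀ A B C D E → (A ∪ B) ∪ (C ∪ D) ∪ E ≐ B ∪ D ∪ A ∪ C ∪ E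
∪-interleave A B C D E w = mk⇔
  (λ { (inj₁ (inj₁ a))        → inj₂ (inj₂ (inj₁ a))
     ; (inj₁ (inj₂ b))        → inj₁ b
     ; (inj₂ (inj₁ (inj₁ c))) → inj₂ (inj₂ (inj₂ (inj₁ c)))
     ; (inj₂ (inj₁ (inj₂ d))) → inj₂ (inj₁ d)
     ; (inj₂ (inj₂ e))        → inj₂ (inj₂ (inj₂ (inj₂ e))) })
  (λ { (inj₁ b)                      → inj₁ (inj₂ b)
     ; (inj₂ (inj₁ d))               → inj₂ (inj₁ (inj₂ d))
     ; (inj₂ (inj₂ (inj₁ a)))        → inj₁ (inj₁ a)
     ; (inj₂ (inj₂ (inj₂ (inj₁ c)))) → inj₂ (inj₁ (inj₁ c))
     ; (inj₂ (inj₂ (inj₂ (inj₂ e)))) → inj₂ (inj₂ e) })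

-- Exponent bookkeeping: the trailing block of 1s in a word of ℱ(n+1) that
-- starts with 0 has the same length as in the corresponding word of 𝒯(n).
trailing-ones : ∀ a k j → suc a ∸ k ∸ suc j ≡ a ∸ k ∸ j
trailing-ones a k j = begin
  suc a ∸ k ∸ suc j    ≡⟨ ∸-+-assoc (suc a) k (suc j) ⟩
  suc a ∸ (k + suc j)  ≡⟨ cong (suc a ∸_) (+-suc k j) ⟩
  a ∸ (k + j)          ≡⟨ sym (∸-+-assoc a k j) ⟩
  a ∸ k ∸ j            ∎
  where open ≡-Reasoning

-- The foil recursion ℱ(n+1) = 0𝒯(n) ∪ 1ℱ(n) for n = m + 1 ≥ 1: a foil word
-- either starts with its first 0 (the rest is a twist-loop word) or with a
-- 1 (the rest is a shorter foil word).
ℱ-recursion : ∀ m → ℱ (suc (suc m)) ≐ (false ∷ []) · 𝒯 (suc m) ∪ (true ∷ []) · ℱ (suc m)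
ℱ-recursion m w = mk⇔ (split m w) (join m w)
  where
  split : ∀ m w → ℱ (suc (suc m)) w →
          ((false ∷ []) · 𝒯 (suc m) ∪ (true ∷ []) · ℱ (suc m)) w
  split zero    _ (inj₁ (zero , zero , z≤n , z≤n , refl)) = inj₁ (_ , refl , refl)
  split zero    _ (inj₂ refl)                             = inj₂ (_ , refl , refl)
  split (suc m) _ (inj₁ (zero , k , _ , k≤ , refl)) =
    inj₁ (_ , (k , k≤ , refl) ,
          cong (λ e → false ∷ 1^ k ++ false ∷ 1^ e) (trailing-ones (suc (suc m)) k 1))
  split (suc m) _ (inj₁ (suc p , k , s≤s p≤ , k≤ , refl)) =
    inj₂ (_ , inj₁ (p , k , p≤ , k≤ , refl) , refl)
  split (suc m) _ (inj₂ refl) = inj₂ (_ , inj₂ refl , refl)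

  join : ∀ m w → ((false ∷ []) · 𝒯 (suc m) ∪ (true ∷ []) · ℱ (suc m)) w →
         ℱ (suc (suc m)) w
  join zero    _ (inj₁ (_ , refl , refl)) = inj₁ (0 , 0 , z≤n , z≤n , refl)
  join zero    _ (inj₂ (_ , refl , refl)) = inj₂ refl
  join (suc m) _ (inj₁ (_ , (k , k≤ , refl) , refl)) =
    inj₁ (0 , k , z≤n , k≤ ,
          cong (λ e → false ∷ 1^ k ++ false ∷ 1^ e) (sym (trailing-ones (suc (suc m)) k 1)))
  join (suc m) _ (inj₂ (_ , inj₁ (p , k , p≤ , k≤ , refl) , refl)) =
    inj₁ (suc p , k , s≤s p≤ , k≤ , refl)
  join (suc m) _ (inj₂ (_ , inj₂ refl , refl)) = inj₂ refl

prefixed-ℱ-recursion : ∀ u m →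
  u · ℱ (suc (suc m)) ≐ (u ++ false ∷ []) · 𝒯 (suc m) ∪ (u ++ true ∷ []) · ℱ (suc m)
prefixed-ℱ-recursion u m = begin
  u · ℱ (suc (suc m))
    ≈⟨ ·-cong u (ℱ-recursion m) ⟩
  u · ((false ∷ []) · 𝒯 (suc m) ∪ (true ∷ []) · ℱ (suc m))
    ≈⟨ ·-distrib-∪ u _ _ ⟩
  u · (false ∷ []) · 𝒯 (suc m) ∪ u · (true ∷ []) · ℱ (suc m)
    ≈⟨ ∪-cong (·-assoc u _ _) (·-assoc u _ _) ⟩
  (u ++ false ∷ []) · 𝒯 (suc m) ∪ (u ++ true ∷ []) · ℱ (suc m)
    ∎
  where open SetoidReasoning ≐-setoid

mainTheorem19 : (n : ℕ) → 1 ≤ n →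
    𝔗 (suc n) ≐
      ((false ∷ true ∷ true ∷ []) · ℱ n) ∪ ((true ∷ false ∷ true ∷ []) · ℱ n)
      ∪ ((false ∷ true ∷ false ∷ []) · 𝒯 n) ∪ ((true ∷ false ∷ false ∷ []) · 𝒯 n)
      ∪ ((false ∷ false ∷ []) · 𝒯 (suc n)) ∪ ((true ∷ true ∷ []) · 𝒯 (suc n))
mainTheorem19 (suc m) _ = begin
  𝔗 (suc (suc m))
    ≈⟨ ∪-cong (prefixed-ℱ-recursion (false ∷ true ∷ []) m)
              (∪-cong (prefixed-ℱ-recursion (true ∷ false ∷ []) m) ≐-refl) ⟩
  ((false ∷ true ∷ false ∷ []) · 𝒯 (suc m) ∪ (false ∷ true ∷ true ∷ []) · ℱ (suc m))
  ∪ ((true ∷ false ∷ false ∷ []) · 𝒯 (suc m) ∪ (true ∷ false ∷ true ∷ []) · ℱ (suc m))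
  ∪ (false ∷ false ∷ []) · 𝒯 (suc (suc m)) ∪ (true ∷ true ∷ []) · 𝒯 (suc (suc m))
    ≈⟨ ∪-interleave _ _ _ _ _ ⟩
  (false ∷ true ∷ true ∷ []) · ℱ (suc m) ∪ (true ∷ false ∷ true ∷ []) · ℱ (suc m)
  ∪ (false ∷ true ∷ false ∷ []) · 𝒯 (suc m) ∪ (true ∷ false ∷ false ∷ []) · 𝒯 (suc m)
  ∪ (false ∷ false ∷ []) · 𝒯 (suc (suc m)) ∪ (true ∷ true ∷ []) · 𝒯 (suc (suc m))
    ∎
  where open SetoidReasoning ≐-setoid
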